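{- Let $s$ be an odd positive integer and let $H$ be a Hadamard matrix of size $4s\times4s$, i.e. a matrix with entries $\pm1$ such that ${}^tH H=4s\,\mathcal{I}$. Remove the first column of $H$ to obtain a $4s\times(4s-1)$ matrix, and from it form two $0/1$ matrices: $H_1$, obtained by replacing each entry $1$ by $0$ and each entry $-1$ by $1$; and $H_2$, obtained by replacing each entry $-1$ by $0$ (entries $1$ kept as $1$). Let $A\subset\mathbb{F}_2^{4s-1}$ be the set of all rows of $H_1$ and of $H_2$. Then $A$ is a Hurwitzian set, i.e. for all distinct $x,x'\in A$ the Hamming weight of $x+x'$ is not a multiple of $4$.
   Context: The Hamming weight of $x\in\mathbb{F}_2^m$ is the number of coordinates of $x$ equal to $1$. -}

module Defs where

open import Data.Nat using (ℕ; zero; suc; _+_; _*_; _%_)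
open import Data.Integer as ℤ using (ℤ; +_; -_)
open import Data.Fin using (Fin; suc)
import Data.Bool
open Data.Bool using (Bool; true; false; _xor_; if_then_else_)
open import Data.Vec using (Vec; tabulate; count; zipWith)
open import Data.List using (List; map; sum; allFin)
open import Relation.Binary.PropositionalEquality using (_≡_)
open import Data.Sum using (_⊎_)
open import Data.Product using (∃)
open import Relation.Nullary using (¬_; yes; no)
open import Relation.Nullary.Decidable using (⌊_⌋)
open import Data.Fin using (_≟_)
open import Data.List using (foldr)

-- A square matrix of integers, as a function of (row, column).
Matrix : ℕ → Set
Matrix n = Fin n → Fin n → ℤ

Σℤ : (n : ℕ) → (Fin n → ℤ) → ℤ
Σℤ n f = foldr ℤ._+_ (+ 0) (map f (allFin n))

δ : {n : ℕ} → Fin n → Fin n → ℤ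
δ i j with i ≟ j
... | yes _ = + 1
... | no  _ = + 0

record IsHadamard (n : ℕ) (H : Matrix n) : Set where
  field
    entries : ∀ i j → (H i j ≡ + 1) ⊎ (H i j ≡ - (+ 1))
    orth    : ∀ j k → Σℤ n (λ i → H i j ℤ.* H i k) ≡ (+ n) ℤ.* δ j k

-- Hamming weight of a vector over F₂ (Bool, true = 1).
weight : {m : ℕ} → Vec Bool m → ℕ
weight {m} x = count (λ b → b Data.Bool.≟ true) x

_⊕_ : {m : ℕ} → Vec Bool m → Vec Bool m → Vec Bool m
_⊕_ = zipWith _xor_

row₁ : {m : ℕ} → Matrix (suc m) → Fin (suc m) → Vec Bool m
row₁ H i = tabulate (λ j → if isOne (H i (suc j)) then false else true)
  where
  isOne : ℤ → Bool
  isOne z = ⌊ ℤ._≟_ z (+ 1) ⌋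

row₂ : {m : ℕ} → Matrix (suc m) → Fin (suc m) → Vec Bool m
row₂ H i = tabulate (λ j → if isOne (H i (suc j)) then true else false)
  where
  isOne : ℤ → Bool
  isOne z = ⌊ ℤ._≟_ z (+ 1) ⌋

InA : {m : ℕ} → Matrix (suc m) → Vec Bool m → Set
InA H x = (∃ λ i → row₁ H i ≡ x) ⊎ (∃ λ i → row₂ H i ≡ x)

Hurwitzian : {m : ℕ} → (Vec Bool m → Set) → Set
Hurwitzian {m} A = ∀ (x x' : Vec Bool m) → A x → A x' →
  ¬ (x ≡ x') → ¬ (weight (x ⊕ x') % 4 ≡ 0)

module Submission where

-- Let H be a Hadamard matrix of order n = m + 1 = 4s with s odd, s = 1 + 2t.
--
-- The hypothesis ᵗH H = n I is about columns, the
--    argument needs rows.  For G = H ᵗH one gets G H = n H, hence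
--    Σₖ G_ik² = n · G_ii = n² = G_ii².  A sum of squares equal to one of its
--    terms has all other terms zero, so G_ik = 0 for k ≠ i.
-- 2. Counting.  With column 0 removed, rows i ≠ k of H agree in a and disagree
--    in d of the m positions: a + d = m and 0 = G_ik = H_i0 H_k0 + a - d.  So a
--    and d differ by one, and as m = 3 + 8t they are 1 + 4t and 2 + 4t.
-- 3. Bit rows.  The rows of H₁ and H₂ are the bit patterns of the rows of H,
--    complemented for H₁.  Two rows of the same family add up to a vector of
--    weight d, two rows of different families to one of weight a (= m if
--    i = k), and none of 1 + 4t, 2 + 4t, 3 + 8t is a multiple of 4.

open import Defs
open import Algebra.Bundles using (CommutativeRing)
open import Data.Bool using (Bool; true; false; not; _xor_; if_then_else_)
open import Data.Bool.Properties using (xor-same; xor-inverseʳ; xor-∧-commutativeRing)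
open import Data.Fin using (Fin; zero; suc; punchIn; _≟_)
open import Data.Fin.Properties using (punchInᵢ≢i)
open import Data.Integer as Int using (ℤ; +_; -_; 0ℤ; +≤+)
import Data.Integer.Properties as ℤP
import Data.List as List
open import Data.List.Properties using (map-tabulate)
open import Data.Nat as Nat using (ℕ; zero; suc; z≤n)
import Data.Nat.Properties as ℕP
open import Data.Nat.DivMod using (m≡m%n+[m/n]*n; [m+kn]%n≡m%n)
open import Data.Product using (∃₂; _,_)
open import Data.Sum using (_⊎_; inj₁; inj₂; reduce; swap)
open import Data.Vec using (Vec; tabulate; _∷_)
open import Data.Vec.Properties using (tabulate-cong)
open import Function using (_∘_; id)
open import Relation.Binary.PropositionalEquality
open import Relation.Nullary using (¬_; Dec; yes; no; contradiction)
open import Relation.Nullary.Decidable using (⌊_⌋)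

open import Algebra.Properties.Semiring.Sum ℤP.+-*-semiring
  using (sum; sum-syntax; sum-cong-≗; sum-remove; sum-replicate-zero; ∑-distrib-+; ∑-comm; *-distribˡ-sum)
open import Algebra.Properties.CommutativeSemigroup
  (CommutativeRing.+-commutativeSemigroup xor-∧-commutativeRing) using (interchange)

module IntegerSums where
  open Int using (_+_; _*_; _≤_)
  open import Data.Integer.Tactic.RingSolver using (solve-∀)
  open ≡-Reasoning

  Σℤ≡∑ : ∀ n (f : Fin n → ℤ) → Σℤ n f ≡ ∑[ i < n ] f i
  Σℤ≡∑ n f = trans (cong (List.foldr _+_ 0ℤ) (map-tabulate id f)) (fold-tabulate f)
    where
    fold-tabulate : ∀ {k} (g : Fin k → ℤ) → List.foldr _+_ 0ℤ (List.tabulate g) ≡ sum g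
    fold-tabulate {zero}  g = refl
    fold-tabulate {suc k} g = cong (λ x → g zero + x) (fold-tabulate (g ∘ suc))

  ∑-ones : ∀ n → ∑[ i < n ] (+ 1) ≡ + n
  ∑-ones zero    = refl
  ∑-ones (suc n) = cong (λ x → + 1 + x) (∑-ones n)

  δ-diag : ∀ {n} (j : Fin n) → δ j j ≡ + 1
  δ-diag j with j ≟ j
  ... | yes _   = refl
  ... | no j≢j = contradiction refl j≢j

  δ-off : ∀ {n} {k j : Fin n} → k ≢ j → δ k j ≡ 0ℤ
  δ-off {k = k} {j} k≢j with k ≟ j
  ... | yes k≡j = contradiction k≡j k≢j
  ... | no _    = refl

  ∑-δ : ∀ {n} (g : Fin n → ℤ) (j : Fin n) → ∑[ k < n ] (g k * δ k j) ≡ g j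
  ∑-δ {suc n} g j = begin
    ∑[ k < suc n ] (g k * δ k j)
      ≡⟨ sum-remove {i = j} (λ k → g k * δ k j) ⟩
    g j * δ j j + ∑[ l < n ] (g (punchIn j l) * δ (punchIn j l) j)
      ≡⟨ cong₂ _+_ (cong (g j *_) (δ-diag j)) (trans (sum-cong-≗ off-terms) (sum-replicate-zero n)) ⟩
    g j * + 1 + 0ℤ
      ≡⟨ trans (ℤP.+-identityʳ _) (ℤP.*-identityʳ (g j)) ⟩
    g j ∎
    where
    off-terms : ∀ l → g (punchIn j l) * δ (punchIn j l) j ≡ 0ℤ
    off-terms l = trans (cong (g (punchIn j l) *_) (δ-off (punchInᵢ≢i j l))) (ℤP.*-zeroʳ (g (punchIn j l)))

  ∑-transpose : ∀ {m n} (a : Fin n → ℤ) (b : Fin n → Fin m → ℤ) (c : Fin m → ℤ) →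
    ∑[ k < n ] (a k * ∑[ j < m ] (c j * b k j)) ≡ ∑[ j < m ] (c j * ∑[ k < n ] (b k j * a k))
  ∑-transpose {m} {n} a b c = begin
    ∑[ k < n ] (a k * ∑[ j < m ] (c j * b k j))
      ≡⟨ sum-cong-≗ (λ k → *-distribˡ-sum (a k) (λ j → c j * b k j)) ⟩
    ∑[ k < n ] ∑[ j < m ] (a k * (c j * b k j))
      ≡⟨ sum-cong-≗ (λ k → sum-cong-≗ (λ j → rotate (a k) (c j) (b k j))) ⟩
    ∑[ k < n ] ∑[ j < m ] (c j * (b k j * a k))
      ≡⟨ ∑-comm (λ k j → c j * (b k j * a k)) ⟩
    ∑[ j < m ] ∑[ k < n ] (c j * (b k j * a k))
      ≡⟨ sum-cong-≗ (λ j → *-distribˡ-sum (c j) (λ k → b k j * a k)) ⟨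
    ∑[ j < m ] (c j * ∑[ k < n ] (b k j * a k)) ∎
    where
    rotate : ∀ x y z → x * (y * z) ≡ y * (z * x)
    rotate = solve-∀

  square-nonneg : ∀ i → 0ℤ ≤ i * i
  square-nonneg (+ n)        = subst (0ℤ ≤_) (sym (ℤP.+◃n≡+n (n Nat.* n))) (+≤+ z≤n)
  square-nonneg Int.-[1+ n ] = subst (0ℤ ≤_) (sym (ℤP.+◃n≡+n (suc n Nat.* suc n))) (+≤+ z≤n)

  square-zero : ∀ {i} → i * i ≡ 0ℤ → i ≡ 0ℤ
  square-zero {i} i²≡0 = reduce (ℤP.i*j≡0⇒i≡0∨j≡0 i i²≡0)

  ∑-nonneg : ∀ {n} (g : Fin n → ℤ) → (∀ k → 0ℤ ≤ g k) → 0ℤ ≤ ∑[ k < n ] g k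
  ∑-nonneg {zero}  g g≥0 = ℤP.≤-refl
  ∑-nonneg {suc n} g g≥0 = ℤP.+-mono-≤ (g≥0 zero) (∑-nonneg (g ∘ suc) (g≥0 ∘ suc))

  -- In a vanishing sum of non-negative integers the first term vanishes:
  -- it lies between 0 and the whole sum.
  ∑-nonneg-zero-head : ∀ {n} (g : Fin (suc n) → ℤ) → (∀ k → 0ℤ ≤ g k) →
    sum g ≡ 0ℤ → g zero ≡ 0ℤ
  ∑-nonneg-zero-head g g≥0 total = ℤP.≤-antisym
    (subst (g zero ≤_) total (ℤP.i≤i+j (g zero) _ {{Int.nonNegative (∑-nonneg _ (g≥0 ∘ suc))}}))
    (g≥0 zero)

  ∑-nonneg-zero : ∀ {n} (g : Fin n → ℤ) → (∀ k → 0ℤ ≤ g k) →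
    ∑[ k < n ] g k ≡ 0ℤ → ∀ k → g k ≡ 0ℤ
  ∑-nonneg-zero {suc n} g g≥0 total zero    = ∑-nonneg-zero-head g g≥0 total
  ∑-nonneg-zero {suc n} g g≥0 total (suc k) = ∑-nonneg-zero (g ∘ suc) (g≥0 ∘ suc) tail-zero k
    where
    tail-zero : sum (g ∘ suc) ≡ 0ℤ
    tail-zero = begin
      sum (g ∘ suc)          ≡⟨ ℤP.+-identityˡ _ ⟨
      0ℤ + sum (g ∘ suc)     ≡⟨ cong (_+ sum (g ∘ suc)) (∑-nonneg-zero-head g g≥0 total) ⟨
      g zero + sum (g ∘ suc) ≡⟨ total ⟩
      0ℤ ∎

  squares-concentrated : ∀ {n} (f : Fin n → ℤ) (i : Fin n) →
    ∑[ k < n ] (f k * f k) ≡ f i * f i → ∀ k → k ≢ i → f k ≡ 0ℤ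
  squares-concentrated {n} f i total k k≢i =
    square-zero (trans (sym (excess-off k≢i)) (∑-nonneg-zero excess excess-nonneg excess-sum k))
    where
    excess : Fin n → ℤ
    excess l = f l * f l + (- (f i * f i)) * δ l i

    excess-off : ∀ {l} → l ≢ i → excess l ≡ f l * f l
    excess-off {l} l≢i = begin
      f l * f l + (- (f i * f i)) * δ l i ≡⟨ cong (λ d → f l * f l + (- (f i * f i)) * d) (δ-off l≢i) ⟩
      f l * f l + (- (f i * f i)) * 0ℤ    ≡⟨ cong (λ x → f l * f l + x) (ℤP.*-zeroʳ (- (f i * f i))) ⟩
      f l * f l + 0ℤ                      ≡⟨ ℤP.+-identityʳ _ ⟩
      f l * f l ∎

    excess-diag : excess i ≡ 0ℤ
    excess-diag = begin
      f i * f i + (- (f i * f i)) * δ i i ≡⟨ cong (λ d → f i * f i + (- (f i * f i)) * d) (δ-diag i) ⟩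
      f i * f i + (- (f i * f i)) * + 1   ≡⟨ cong (λ x → f i * f i + x) (ℤP.*-identityʳ (- (f i * f i))) ⟩
      f i * f i + - (f i * f i)           ≡⟨ ℤP.+-inverseʳ (f i * f i) ⟩
      0ℤ ∎

    excess-nonneg : ∀ l → 0ℤ ≤ excess l
    excess-nonneg l = by-cases (l ≟ i)
      where
      by-cases : Dec (l ≡ i) → 0ℤ ≤ excess l
      by-cases (yes refl) = subst (0ℤ ≤_) (sym excess-diag) ℤP.≤-refl
      by-cases (no l≢i)   = subst (0ℤ ≤_) (sym (excess-off l≢i)) (square-nonneg (f l))

    excess-sum : sum excess ≡ 0ℤ
    excess-sum = begin
      sum excess ≡⟨ ∑-distrib-+ (λ l → f l * f l) (λ l → (- (f i * f i)) * δ l i) ⟩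
      ∑[ l < n ] (f l * f l) + ∑[ l < n ] ((- (f i * f i)) * δ l i)
        ≡⟨ cong₂ _+_ total (∑-δ (λ _ → - (f i * f i)) i) ⟩
      f i * f i + - (f i * f i)                               ≡⟨ ℤP.+-inverseʳ (f i * f i) ⟩
      0ℤ ∎

open IntegerSums

module RowOrthogonality {n : ℕ} (H : Fin n → Fin n → ℤ)
  (row-norm : ∀ i → ∑[ j < n ] (H i j Int.* H i j) ≡ + n)
  (col-orth : ∀ j l → ∑[ k < n ] (H k j Int.* H k l) ≡ + n Int.* δ j l) where
  open Int using (_+_; _*_)
  open import Data.Integer.Tactic.RingSolver using (solve-∀)
  open ≡-Reasoning

  gram : Fin n → Fin n → ℤ
  gram i k = ∑[ j < n ] (H i j * H k j)

  -- G H = n H, read at entry (i, j); this uses only the orthogonality of the columns.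
  gram-H : ∀ i j → ∑[ k < n ] (H k j * gram i k) ≡ + n * H i j
  gram-H i j = begin
    ∑[ k < n ] (H k j * gram i k)                 ≡⟨ ∑-transpose (λ k → H k j) H (H i) ⟩
    ∑[ l < n ] (H i l * ∑[ k < n ] (H k l * H k j)) ≡⟨ sum-cong-≗ (λ l → cong (H i l *_) (col-orth l j)) ⟩
    ∑[ l < n ] (H i l * (+ n * δ l j))            ≡⟨ sum-cong-≗ (λ l → regroup (H i l) (+ n) (δ l j)) ⟩
    ∑[ l < n ] ((+ n * H i l) * δ l j)            ≡⟨ ∑-δ (λ l → + n * H i l) j ⟩
    + n * H i j ∎
    where
    regroup : ∀ x y z → x * (y * z) ≡ (y * x) * z
    regroup = solve-∀

  gram-row-norm : ∀ i → ∑[ k < n ] (gram i k * gram i k) ≡ + n * + n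
  gram-row-norm i = begin
    ∑[ k < n ] (gram i k * gram i k)               ≡⟨ ∑-transpose (gram i) H (H i) ⟩
    ∑[ j < n ] (H i j * ∑[ k < n ] (H k j * gram i k)) ≡⟨ sum-cong-≗ (λ j → cong (H i j *_) (gram-H i j)) ⟩
    ∑[ j < n ] (H i j * (+ n * H i j))             ≡⟨ sum-cong-≗ (λ j → regroup (H i j) (+ n)) ⟩
    ∑[ j < n ] (+ n * (H i j * H i j))             ≡⟨ *-distribˡ-sum (+ n) (λ j → H i j * H i j) ⟨
    + n * ∑[ j < n ] (H i j * H i j)               ≡⟨ cong (+ n *_) (row-norm i) ⟩
    + n * + n ∎
    where
    regroup : ∀ x y → x * (y * x) ≡ y * (x * x)
    regroup = solve-∀

  rows-orthogonal : ∀ i k → k ≢ i → gram i k ≡ 0ℤ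
  rows-orthogonal i = squares-concentrated (gram i) i
    (trans (gram-row-norm i) (sym (cong₂ _*_ (row-norm i) (row-norm i))))

module HammingWeight where
  ⟦_⟧ : Bool → ℤ
  ⟦ true ⟧  = + 1
  ⟦ false ⟧ = 0ℤ

  weight-∑ : ∀ {m} (f : Fin m → Bool) → + weight (tabulate f) ≡ ∑[ j < m ] ⟦ f j ⟧
  weight-∑ {zero}  f = refl
  weight-∑ {suc m} f with f zero
  ... | true  = cong (λ x → + 1 Int.+ x) (weight-∑ (f ∘ suc))
  ... | false = trans (weight-∑ (f ∘ suc)) (sym (ℤP.+-identityˡ _))

  weight-complement : ∀ {m} (f : Fin m → Bool) →
    weight (tabulate (not ∘ f)) Nat.+ weight (tabulate f) ≡ m
  weight-complement {zero}  f = refl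
  weight-complement {suc m} f with f zero
  ... | true  = trans (ℕP.+-suc _ _) (cong suc (weight-complement (f ∘ suc)))
  ... | false = cong suc (weight-complement (f ∘ suc))

  weight-ones : ∀ m → weight (tabulate {n = m} (λ _ → true)) ≡ m
  weight-ones zero    = refl
  weight-ones (suc m) = cong suc (weight-ones m)

  ⊕-tabulate : ∀ {m} (f g : Fin m → Bool) → tabulate f ⊕ tabulate g ≡ tabulate (λ j → f j xor g j)
  ⊕-tabulate {zero}  f g = refl
  ⊕-tabulate {suc m} f g = cong ((f zero xor g zero) ∷_) (⊕-tabulate (f ∘ suc) (g ∘ suc))

open HammingWeight

module Mod4 where
  open Nat using (_+_; _*_; _%_; _/_)
  open import Data.Nat.Tactic.RingSolver using (solve-∀)
  open ≡-Reasoning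

  NotDiv4 : ℕ → Set
  NotDiv4 w = ¬ (w % 4 ≡ 0)

  Adjacent : ℕ → ℕ → Set
  Adjacent a d = d ≡ suc a ⊎ a ≡ suc d

  odd-order : ∀ s {m} → s % 2 ≡ 1 → suc m ≡ 4 * s → m ≡ 3 + (s / 2) * 8
  odd-order s {m} s-odd order = ℕP.suc-injective (begin
    suc m                       ≡⟨ order ⟩
    4 * s                       ≡⟨ cong (4 *_) (m≡m%n+[m/n]*n s 2) ⟩
    4 * (s % 2 + s / 2 * 2)     ≡⟨ cong (λ r → 4 * (r + s / 2 * 2)) s-odd ⟩
    4 * (1 + s / 2 * 2)         ≡⟨ expand (s / 2) ⟩
    suc (3 + s / 2 * 8) ∎)
    where
    expand : ∀ t → 4 * (1 + t * 2) ≡ suc (3 + t * 8)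
    expand = solve-∀

  shift-not-div4 : ∀ r t → NotDiv4 r → NotDiv4 (r + t * 4)
  shift-not-div4 r t r≢0 r+4t≡0 = r≢0 (trans (sym ([m+kn]%n≡m%n r t 4)) r+4t≡0)

  order-not-div4 : ∀ {m} t → m ≡ 3 + t * 8 → NotDiv4 m
  order-not-div4 t refl = subst NotDiv4 (regroup t) (shift-not-div4 3 (t * 2) (λ ()))
    where
    regroup : ∀ t → 3 + t * 2 * 4 ≡ 3 + t * 8
    regroup = solve-∀

  smaller-half : ∀ {d t} → suc d + d ≡ 3 + t * 8 → d ≡ 1 + t * 4
  smaller-half {d} {t} sum≡ = ℕP.*-cancelˡ-≡ d (1 + t * 4) 2 (ℕP.suc-injective (begin
    suc (2 * d)             ≡⟨ double d ⟩
    suc d + d               ≡⟨ sum≡ ⟩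
    3 + t * 8               ≡⟨ double-half t ⟩
    suc (2 * (1 + t * 4)) ∎))
    where
    double : ∀ d → suc (2 * d) ≡ suc d + d
    double = solve-∀
    double-half : ∀ t → 3 + t * 8 ≡ suc (2 * (1 + t * 4))
    double-half = solve-∀

  adjacent-not-div4 : ∀ {a d} t → a + d ≡ 3 + t * 8 → Adjacent a d → NotDiv4 d
  adjacent-not-div4 {a} t sum≡ (inj₁ refl) =
    subst NotDiv4 (sym (cong suc (smaller-half {a} {t} (trans (ℕP.+-comm (suc a) a) sum≡))))
      (shift-not-div4 2 t (λ ()))
  adjacent-not-div4 {d = d} t sum≡ (inj₂ refl) =
    subst NotDiv4 (sym (smaller-half {d} {t} sum≡)) (shift-not-div4 1 t (λ ()))

open Mod4

module Signs where
  open Int using (_+_; _*_)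
  open import Data.Integer.Tactic.RingSolver using (solve-∀)
  open ≡-Reasoning

  PlusMinusOne : ℤ → Set
  PlusMinusOne z = (z ≡ + 1) ⊎ (z ≡ - (+ 1))

  -- The bit of an entry, by the same test as in row₁ and row₂.
  bit : ℤ → Bool
  bit z = ⌊ z Int.≟ + 1 ⌋

  square-pm : ∀ {z} → PlusMinusOne z → z * z ≡ + 1
  square-pm (inj₁ refl) = refl
  square-pm (inj₂ refl) = refl

  product-pm : ∀ {z z'} → PlusMinusOne z → PlusMinusOne z' → PlusMinusOne (z * z')
  product-pm (inj₁ refl) (inj₁ refl) = inj₁ refl
  product-pm (inj₁ refl) (inj₂ refl) = inj₂ refl
  product-pm (inj₂ refl) (inj₁ refl) = inj₂ refl
  product-pm (inj₂ refl) (inj₂ refl) = inj₁ refl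

  -- z z' is 1 when the bits agree and -1 when they differ.
  sign-product : ∀ {z z'} → PlusMinusOne z → PlusMinusOne z' →
    z * z' + + 2 * ⟦ bit z xor bit z' ⟧ ≡ + 1
  sign-product (inj₁ refl) (inj₁ refl) = refl
  sign-product (inj₁ refl) (inj₂ refl) = refl
  sign-product (inj₂ refl) (inj₁ refl) = refl
  sign-product (inj₂ refl) (inj₂ refl) = refl

  adjacent-by-sign : ∀ {e a d} → PlusMinusOne e → + d ≡ e + + a → Adjacent a d
  adjacent-by-sign (inj₁ refl) d≡1+a = inj₁ (ℤP.+-injective d≡1+a)
  adjacent-by-sign {a = a} {d} (inj₂ refl) d≡a-1 = inj₂ (ℤP.+-injective (begin
    + a                      ≡⟨ cancel (+ a) ⟩
    + 1 + (- (+ 1) + + a)    ≡⟨ cong (λ x → + 1 + x) d≡a-1 ⟨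
    + 1 + + d ∎))
    where
    cancel : ∀ x → x ≡ + 1 + (- (+ 1) + x)
    cancel = solve-∀

open Signs

module HadamardRows {m : ℕ} (H : Matrix (suc m)) (hadamard : IsHadamard (suc m) H) where
  open IsHadamard hadamard
  open Int using (_+_; _*_; _-_)
  open import Data.Integer.Tactic.RingSolver using (solve-∀)
  open ≡-Reasoning

  open RowOrthogonality H
    (λ i → trans (sum-cong-≗ (λ j → square-pm (entries i j))) (∑-ones (suc m)))
    (λ j l → trans (sym (Σℤ≡∑ (suc m) (λ i → H i j * H i l))) (orth j l))
    using (rows-orthogonal)

  differ : Fin (suc m) → Fin (suc m) → Fin m → Bool
  differ i k j = bit (H i (suc j)) xor bit (H k (suc j))

  agreements disagreements : Fin (suc m) → Fin (suc m) → ℕ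
  agreements i k    = weight (tabulate (not ∘ differ i k))
  disagreements i k = weight (tabulate (differ i k))

  tail-inner-product : ∀ i k →
    ∑[ j < m ] (H i (suc j) * H k (suc j)) + + 2 * + disagreements i k ≡ + m
  tail-inner-product i k = begin
    T + + 2 * + disagreements i k               ≡⟨ cong (λ w → T + + 2 * w) (weight-∑ (differ i k)) ⟩
    T + + 2 * ∑[ j < m ] ⟦ differ i k j ⟧         ≡⟨ cong (λ w → T + w) (*-distribˡ-sum (+ 2) (λ j → ⟦ differ i k j ⟧)) ⟩
    T + ∑[ j < m ] (+ 2 * ⟦ differ i k j ⟧)       ≡⟨ ∑-distrib-+ product (λ j → + 2 * ⟦ differ i k j ⟧) ⟨
    ∑[ j < m ] (product j + + 2 * ⟦ differ i k j ⟧)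
      ≡⟨ sum-cong-≗ (λ j → sign-product (entries i (suc j)) (entries k (suc j))) ⟩
    ∑[ j < m ] (+ 1)                              ≡⟨ ∑-ones m ⟩
    + m ∎
    where
    product : Fin m → ℤ
    product j = H i (suc j) * H k (suc j)
    T : ℤ
    T = sum product

  -- Distinct rows agree in one position more, or one fewer, than they disagree:
  -- with the corner product e = ±1, orthogonality reads e + a - d = 0.
  rows-adjacent : ∀ i k → k ≢ i → Adjacent (agreements i k) (disagreements i k)
  rows-adjacent i k k≢i = adjacent-by-sign (product-pm (entries i zero) (entries k zero)) (begin
    + d                                     ≡⟨ isolate (+ d) e T (+ a) ⟩
    (T + + 2 * + d) - (+ a + + d) - (e + T) + (e + + a)
      ≡⟨ cong₂ (λ x y → x - y - (e + T) + (e + + a)) (tail-inner-product i k) a+d≡m ⟩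
    + m - + m - (e + T) + (e + + a)         ≡⟨ cong (λ z → + m - + m - z + (e + + a)) (rows-orthogonal i k k≢i) ⟩
    + m - + m - 0ℤ + (e + + a)              ≡⟨ cancel (+ m) (e + + a) ⟩
    e + + a ∎)
    where
    a d : ℕ
    a = agreements i k
    d = disagreements i k
    e T : ℤ
    e = H i zero * H k zero
    T = ∑[ j < m ] (H i (suc j) * H k (suc j))
    a+d≡m : + a + + d ≡ + m
    a+d≡m = cong +_ (weight-complement (differ i k))
    isolate : ∀ d e T a → d ≡ (T + + 2 * d) - (a + d) - (e + T) + (e + a)
    isolate = solve-∀
    cancel : ∀ x y → x - x - 0ℤ + y ≡ y
    cancel = solve-∀

  bit-row : Bool → Fin (suc m) → Vec Bool m
  bit-row c i = tabulate (λ j → c xor bit (H i (suc j)))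

  A-bit-rows : ∀ {x} → InA H x → ∃₂ λ c i → bit-row c i ≡ x
  A-bit-rows (inj₁ (i , refl)) = true  , i , tabulate-cong (λ j → complement (bit (H i (suc j))))
    where
    complement : ∀ b → true xor b ≡ (if b then false else true)
    complement true  = refl
    complement false = refl
  A-bit-rows (inj₂ (i , refl)) = false , i , tabulate-cong (λ j → keep (bit (H i (suc j))))
    where
    keep : ∀ b → false xor b ≡ (if b then true else false)
    keep true  = refl
    keep false = refl

  bit-row-sum : ∀ c c' i k →
    bit-row c i ⊕ bit-row c' k ≡ tabulate (λ j → (c xor c') xor differ i k j)
  bit-row-sum c c' i k = trans (⊕-tabulate _ _)
    (tabulate-cong (λ j → interchange c (bit (H i (suc j))) c' (bit (H k (suc j)))))

  same-family : ∀ c i k → weight (bit-row c i ⊕ bit-row c k) ≡ disagreements i k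
  same-family c i k = cong weight (trans (bit-row-sum c c i k)
    (tabulate-cong (λ j → cong (_xor differ i k j) (xor-same c))))

  cross-family : ∀ c i k → weight (bit-row c i ⊕ bit-row (not c) k) ≡ agreements i k
  cross-family c i k = cong weight (trans (bit-row-sum c (not c) i k)
    (tabulate-cong (λ j → cong (_xor differ i k j) (xor-inverseʳ c))))

  distinct-indices : ∀ {c i k} → bit-row c i ≢ bit-row c k → k ≢ i
  distinct-indices {c} rows≢ k≡i = rows≢ (cong (bit-row c) (sym k≡i))

  agreements-self : ∀ i → agreements i i ≡ m
  agreements-self i =
    trans (cong weight (tabulate-cong (λ j → cong not (xor-same (bit (H i (suc j))))))) (weight-ones m)

  module _ {t : ℕ} (m≡ : m ≡ 3 Nat.+ t Nat.* 8) where

    split : ∀ i k → agreements i k Nat.+ disagreements i k ≡ 3 Nat.+ t Nat.* 8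
    split i k = trans (weight-complement (differ i k)) m≡

    disagreements-not-div4 : ∀ i k → k ≢ i → NotDiv4 (disagreements i k)
    disagreements-not-div4 i k k≢i = adjacent-not-div4 t (split i k) (rows-adjacent i k k≢i)

    agreements-not-div4 : ∀ i k → NotDiv4 (agreements i k)
    agreements-not-div4 i k = by-cases (k ≟ i)
      where
      by-cases : Dec (k ≡ i) → NotDiv4 (agreements i k)
      by-cases (yes refl) = subst NotDiv4 (sym (agreements-self i)) (order-not-div4 t m≡)
      by-cases (no k≢i)   = adjacent-not-div4 t (trans (ℕP.+-comm (disagreements i k) (agreements i k)) (split i k))
                              (swap (rows-adjacent i k k≢i))

    bit-rows-not-div4 : ∀ c c' i k → bit-row c i ≢ bit-row c' k →
      NotDiv4 (weight (bit-row c i ⊕ bit-row c' k))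
    bit-rows-not-div4 true  true  i k rows≢ =
      subst NotDiv4 (sym (same-family true i k)) (disagreements-not-div4 i k (distinct-indices {true} rows≢))
    bit-rows-not-div4 false false i k rows≢ =
      subst NotDiv4 (sym (same-family false i k)) (disagreements-not-div4 i k (distinct-indices {false} rows≢))
    bit-rows-not-div4 true  false i k _ =
      subst NotDiv4 (sym (cross-family true i k)) (agreements-not-div4 i k)
    bit-rows-not-div4 false true  i k _ =
      subst NotDiv4 (sym (cross-family false i k)) (agreements-not-div4 i k)

    hurwitzian-A : Hurwitzian (InA H)
    hurwitzian-A x x' x∈A x'∈A x≢x' with A-bit-rows x∈A | A-bit-rows x'∈A
    ... | c , i , refl | c' , k , refl = bit-rows-not-div4 c c' i k x≢x'

open Nat using (_*_; _%_)

-- The order 4s with s odd gives m = 3 + 8t for t = s / 2.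
lemma3p1 : (s m : ℕ) → s % 2 ≡ 1 → suc m ≡ 4 * s
    → (H : Matrix (suc m)) → IsHadamard (suc m) H → Hurwitzian (InA H)
lemma3p1 s m s-odd order H hadamard = hurwitzian-A {t = s Nat./ 2} (odd-order s s-odd order)
  where open HadamardRows H hadamard
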